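{- A comprehension category $\mathcal{C}$ has weakly stable $\Pi$-types if and only if it can be equipped with a stable class of $\Pi$-types.
   Context: In a comprehension category ($\mathcal{C}$, cloven fibration $P:\mathcal{T}\to\mathcal{C}$, comprehension $\chi(A):\Gamma.A\to\Gamma$, reindexing $A[\sigma]$), a dependent product ($\Pi$-type) for $\Gamma$, $A\in\mathcal{T}(\Gamma)$, $B\in\mathcal{T}(\Gamma.A)$ is a type $\prod[A,B]\in\mathcal{T}(\Gamma)$, a map $\mathsf{app}_{A,B}:\prod[A,B][\chi(A)]\to B$ in $\mathcal{T}(\Gamma.A)$, and an operation giving for each section $t:\Gamma.A\to\Gamma.A.B$ a section $\lambda(t):\Gamma\to\Gamma.\prod[A,B]$ with $(\Gamma.A.\mathsf{app}_{A,B})\circ(1_{\Gamma.A},\lambda(t))=t$. $\mathcal{C}$ has weakly stable $\Pi$-types if every $\Gamma,A,B$ has some $(\prod[A,B],\mathsf{app}_{A,B})$ such that for every $\sigma:\Delta\to\Gamma$ there is some operation $\lambda$ making $(\prod[A,B][\sigma],\mathsf{app}_{A,B}[\sigma],\lambda)$ a dependent product for $\Delta,A[\sigma],B[\sigma]$. A stable class of $\Pi$-types consists of, for each $\Gamma,A,B$, a non-empty family of $\Pi$-types $(\Pi,\mathsf{app})$ for $A,B$ closed under arbitrary reindexings along any $\sigma$, and for each such good $(\Pi,\mathsf{app})$ and section $t$, a non-empty family of sections (good $\lambda$-abstractions of $t$) similarly closed under reindexing. -}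

module Defs where

open import Level using (Level; _⊔_; suc)
open import Data.Product using (Σ; _×_; _,_; proj₁; proj₂)
open import Relation.Binary.PropositionalEquality
  using (_≡_; refl; sym; trans; cong; subst; module ≡-Reasoning)
open import Function.Bundles using (_⇔_)

record Category (o h : Level) : Set (suc (o ⊔ h)) where
  infixr 9 _∘_
  field
    Ob    : Set o
    Hom   : Ob → Ob → Set h
    id    : ∀ {X} → Hom X X
    _∘_   : ∀ {X Y Z} → Hom Y Z → Hom X Y → Hom X Z
    idˡ   : ∀ {X Y} {f : Hom X Y} → id ∘ f ≡ f
    idʳ   : ∀ {X Y} {f : Hom X Y} → f ∘ id ≡ f
    assoc : ∀ {W X Y Z} {f : Hom Y Z} {g : Hom X Y} {k : Hom W X} →
            (f ∘ g) ∘ k ≡ f ∘ (g ∘ k)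

  -- the square   P --p--> X
  --              |q       |f
  --              Y --g--> Z      is a pullback
  IsPullback : ∀ {P X Y Z} (f : Hom X Z) (g : Hom Y Z) (p : Hom P X) (q : Hom P Y) →
               Set (o ⊔ h)
  IsPullback {P} {X} {Y} {Z} f g p q =
    ∀ {W} (a : Hom W X) (b : Hom W Y) → f ∘ a ≡ g ∘ b →
    Σ (Hom W P) λ u → (p ∘ u ≡ a) × (q ∘ u ≡ b) ×
      (∀ (u' : Hom W P) → p ∘ u' ≡ a → q ∘ u' ≡ b → u' ≡ u)

-- A functor P : T → C presented as a category T displayed over C,
-- and cloven (Grothendieck) fibrations.

record Displayed {o h} (C : Category o h) (t d : Level) : Set (o ⊔ h ⊔ suc (t ⊔ d)) where
  open Category C
  infixr 9 _∘ᵈ_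
  field
    Ty     : Ob → Set t
    -- Over σ B A : morphisms B → A of T lying over σ
    Over   : ∀ {Δ Γ} → Hom Δ Γ → Ty Δ → Ty Γ → Set d
    idᵈ    : ∀ {Γ} {A : Ty Γ} → Over id A A
    _∘ᵈ_   : ∀ {Θ Δ Γ} {σ : Hom Δ Γ} {τ : Hom Θ Δ} {A B C'} →
             Over σ B A → Over τ C' B → Over (σ ∘ τ) C' A
    idˡᵈ   : ∀ {Δ Γ} {σ : Hom Δ Γ} {B A} {f : Over σ B A} →
             subst (λ s → Over s B A) idˡ (idᵈ ∘ᵈ f) ≡ f
    idʳᵈ   : ∀ {Δ Γ} {σ : Hom Δ Γ} {B A} {f : Over σ B A} →
             subst (λ s → Over s B A) idʳ (f ∘ᵈ idᵈ) ≡ f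
    assocᵈ : ∀ {Ξ Θ Δ Γ} {σ : Hom Δ Γ} {τ : Hom Θ Δ} {ρ : Hom Ξ Θ} {A B C' D}
             {f : Over σ B A} {g : Over τ C' B} {k : Over ρ D C'} →
             subst (λ s → Over s D A) assoc ((f ∘ᵈ g) ∘ᵈ k) ≡ f ∘ᵈ (g ∘ᵈ k)

  IsCartesian : ∀ {Δ Γ} {σ : Hom Δ Γ} {A' A} → Over σ A' A → Set (o ⊔ h ⊔ t ⊔ d)
  IsCartesian {Δ} {Γ} {σ} {A'} {A} f =
    ∀ {Θ} (τ : Hom Θ Δ) {C' : Ty Θ} (g : Over (σ ∘ τ) C' A) →
    Σ (Over τ C' A') λ k → (f ∘ᵈ k ≡ g) × (∀ (k' : Over τ C' A') → f ∘ᵈ k' ≡ g → k' ≡ k)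

  _∘f_ : ∀ {Γ} {X Y Z : Ty Γ} → Over id Y Z → Over id X Y → Over id X Z
  _∘f_ {X = X} {Z = Z} f g = subst (λ s → Over s X Z) idˡ (f ∘ᵈ g)

record ClovenFibration {o h} (C : Category o h) (t d : Level) : Set (o ⊔ h ⊔ suc (t ⊔ d)) where
  open Category C
  field
    displayed : Displayed C t d
  open Displayed displayed public
  field
    _[_]      : ∀ {Δ Γ} → Ty Γ → Hom Δ Γ → Ty Δ
    lift      : ∀ {Δ Γ} {A : Ty Γ} {σ : Hom Δ Γ} → Over σ (A [ σ ]) A
    lift-cart : ∀ {Δ Γ} {A : Ty Γ} {σ : Hom Δ Γ} → IsCartesian (lift {A = A} {σ = σ})

record ComprehensionCategory (o h t d : Level) : Set (suc (o ⊔ h ⊔ t ⊔ d)) where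
  field
    base : Category o h
    fib  : ClovenFibration base t d
  open Category base public
  open ClovenFibration fib public
  infixl 5 _▸_
  field
    -- the functor χ : T → C^→ with cod ∘ χ = P
    _▸_    : (Γ : Ob) → Ty Γ → Ob
    χ      : ∀ {Γ} {A : Ty Γ} → Hom (Γ ▸ A) Γ
    ext    : ∀ {Δ Γ} {σ : Hom Δ Γ} {B A} → Over σ B A → Hom (Δ ▸ B) (Γ ▸ A)
    ext-sq : ∀ {Δ Γ} {σ : Hom Δ Γ} {B A} (f : Over σ B A) → χ ∘ ext f ≡ σ ∘ χ
    ext-id : ∀ {Γ} {A : Ty Γ} → ext (idᵈ {A = A}) ≡ id
    ext-∘  : ∀ {Θ Δ Γ} {σ : Hom Δ Γ} {τ : Hom Θ Δ} {A B C'}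
             (f : Over σ B A) (g : Over τ C' B) → ext (f ∘ᵈ g) ≡ ext f ∘ ext g
    ext-pb : ∀ {Δ Γ} {σ : Hom Δ Γ} {B A} (f : Over σ B A) →
             IsCartesian f → IsPullback χ σ (ext f) χ

module Pi {o h t d} (𝒞 : ComprehensionCategory o h t d) where
  open ComprehensionCategory 𝒞

  Section : (Γ : Ob) → Ty Γ → Set h
  Section Γ A = Σ (Hom Γ (Γ ▸ A)) λ s → χ ∘ s ≡ id

  q : ∀ {Δ Γ} (σ : Hom Δ Γ) (A : Ty Γ) → Hom (Δ ▸ A [ σ ]) (Γ ▸ A)
  q σ A = ext (lift {A = A} {σ = σ})

  private
    cone-eq : ∀ {Δ Γ} {X : Ty Γ} (l : Section Γ X) (σ : Hom Δ Γ) →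
              χ ∘ (proj₁ l ∘ σ) ≡ σ ∘ id
    cone-eq l σ = trans (sym assoc) (trans (cong (_∘ σ) (proj₂ l)) (trans idˡ (sym idʳ)))

  reindexSection : ∀ {Δ Γ} {X : Ty Γ} → Section Γ X → (σ : Hom Δ Γ) → Section Δ (X [ σ ])
  reindexSection {X = X} l σ =
    let r = ext-pb (lift {A = X} {σ = σ}) lift-cart (proj₁ l ∘ σ) id (cone-eq l σ)
    in proj₁ r , proj₁ (proj₂ (proj₂ r))

  reindexFib : ∀ {Δ Γ} {X Y : Ty Γ} → Over id X Y → (ρ : Hom Δ Γ) → Over id (X [ ρ ]) (Y [ ρ ])
  reindexFib {X = X} {Y} f ρ =
    proj₁ (lift-cart {A = Y} {σ = ρ} id
      (subst (λ s → Over s (X [ ρ ]) Y) (trans idˡ (sym idʳ)) (f ∘ᵈ lift {A = X} {σ = ρ})))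

  record PiCand (Γ : Ob) (A : Ty Γ) (B : Ty (Γ ▸ A)) : Set (t ⊔ d) where
    constructor piCand
    field
      Π   : Ty Γ
      app : Over id (Π [ χ {Γ} {A} ]) B
  open PiCand public

  IsLam : ∀ {Γ A B} (c : PiCand Γ A B) → Section (Γ ▸ A) B → Section Γ (Π c) → Set h
  IsLam c tm l = ext (app c) ∘ proj₁ (reindexSection l χ) ≡ proj₁ tm

  LamOp : ∀ {Γ A B} → PiCand Γ A B → Set h
  LamOp {Γ} {A} {B} c = (tm : Section (Γ ▸ A) B) → Σ (Section Γ (Π c)) (IsLam c tm)

  canon : ∀ {Δ Γ} {A : Ty Γ} (P : Ty Γ) (σ : Hom Δ Γ) →
          Over id ((P [ σ ]) [ χ {Δ} {A [ σ ]} ]) ((P [ χ {Γ} {A} ]) [ q σ A ])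
  canon {Δ} {Γ} {A} P σ =
    let X  = (P [ σ ]) [ χ {Δ} {A [ σ ]} ]
        g0 = lift {A = P} {σ = σ} ∘ᵈ lift {A = P [ σ ]} {σ = χ {Δ} {A [ σ ]}}
        g1 = subst (λ s → Over s X P) (sym (ext-sq (lift {A = A} {σ = σ}))) g0
        k  = proj₁ (lift-cart {A = P} {σ = χ {Γ} {A}} (q σ A) g1)
    in proj₁ (lift-cart {A = P [ χ {Γ} {A} ]} {σ = q σ A} id
         (subst (λ s → Over s X (P [ χ {Γ} {A} ])) (sym idʳ) k))

  reindexPi : ∀ {Δ Γ A B} → PiCand Γ A B → (σ : Hom Δ Γ) → PiCand Δ (A [ σ ]) (B [ q σ A ])
  reindexPi {A = A} c σ =
    piCand (Π c [ σ ]) (reindexFib (app c) (q σ A) ∘f canon {A = A} (Π c) σ)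

  WeaklyStablePi : Set (o ⊔ h ⊔ t ⊔ d)
  WeaklyStablePi =
    ∀ (Γ : Ob) (A : Ty Γ) (B : Ty (Γ ▸ A)) →
    Σ (PiCand Γ A B) λ c → ∀ (Δ : Ob) (σ : Hom Δ Γ) → LamOp (reindexPi c σ)

  record StableClass (ℓ : Level) : Set (o ⊔ h ⊔ t ⊔ d ⊔ suc ℓ) where
    field
      Good         : ∀ {Γ A B} → PiCand Γ A B → Set ℓ
      good-ne      : ∀ Γ A B → Σ (PiCand Γ A B) Good
      good-stable  : ∀ {Δ Γ A B} {c : PiCand Γ A B} → Good c →
                     (σ : Hom Δ Γ) → Good (reindexPi c σ)
      GoodLam      : ∀ {Γ A B} (c : PiCand Γ A B) →
                     Section (Γ ▸ A) B → Section Γ (Π c) → Set ℓ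
      goodLam-lam  : ∀ {Γ A B} {c : PiCand Γ A B} {tm l} → Good c →
                     GoodLam c tm l → IsLam c tm l
      goodLam-ne   : ∀ {Γ A B} {c : PiCand Γ A B} → Good c →
                     (tm : Section (Γ ▸ A) B) → Σ (Section Γ (Π c)) (GoodLam c tm)
      goodLam-stable : ∀ {Δ Γ A B} {c : PiCand Γ A B} {tm l} → Good c →
                     GoodLam c tm l → (σ : Hom Δ Γ) →
                     GoodLam (reindexPi c σ) (reindexSection tm (q σ A)) (reindexSection l σ)

module Submission where

-- A candidate (Π, app) over Γ is good when, for every σ : Δ → Γ, it admits λ-abstractions over σ:
-- any map tm into Γ.A.B lying over a pullback square (x, p) of χ(A) along σ has a map m : Δ → Γ.Π
-- over σ through which app recovers tm.  Quantifying over all pullback squares, not only the chosen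
-- reindexings, makes this invariant: by pasting pullbacks and transporting app along the canonical
-- comparison Π[σ][χ] → Π[χ][σ.A], λ-abstractions of (Π, app) over σ ∘ τ are the same as those of
-- (Π, app)[σ] over τ.  Over the identity they are exactly λ-operations.  Hence the Π-types of a
-- weakly stable choice are good, good Π-types are closed under reindexing, and all λ-abstractions
-- (which are stable by the same comparison) serve as the good ones; conversely the reindexings of a
-- good Π-type of a stable class are good, so they carry λ-operations.

open import Defs
open import Level using (_⊔_; Lift; lower) renaming (lift to lift-ℓ)
open import Function.Bundles using (_⇔_; mk⇔)
open import Data.Product using (Σ; _×_; _,_; proj₁; proj₂)
open import Relation.Binary.PropositionalEquality
  using (_≡_; refl; sym; trans; cong; subst; module ≡-Reasoning)

module PullbackLemmas {o h} (C : Category o h) where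
  open Category C

  pullˡ : ∀ {W X Y Z} {f : Hom Y Z} {g : Hom X Y} {fg : Hom X Z} {k : Hom W X} →
          f ∘ g ≡ fg → f ∘ (g ∘ k) ≡ fg ∘ k
  pullˡ e = trans (sym assoc) (cong (_∘ _) e)

  extendˡ : ∀ {V W X Y Z} {f : Hom Y Z} {g : Hom X Y} {f' : Hom W Z} {g' : Hom X W}
            {k : Hom V X} → f ∘ g ≡ f' ∘ g' → f ∘ (g ∘ k) ≡ f' ∘ (g' ∘ k)
  extendˡ e = trans (pullˡ e) assoc

  square-paste : ∀ {Q P W X Y Z} {f : Hom X Z} {g : Hom Y Z} {p : Hom P X} {q : Hom P Y}
                 {h : Hom W Y} {p' : Hom Q P} {q' : Hom Q W} →
                 f ∘ p ≡ g ∘ q → q ∘ p' ≡ h ∘ q' → f ∘ (p ∘ p') ≡ (g ∘ h) ∘ q'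
  square-paste right left = trans (extendˡ right) (trans (cong (_ ∘_) left) (sym assoc))

  pullback-jointly-monic :
    ∀ {P X Y Z} {f : Hom X Z} {g : Hom Y Z} {p : Hom P X} {q : Hom P Y} →
    IsPullback f g p q → f ∘ p ≡ g ∘ q →
    ∀ {W} {u u' : Hom W P} → p ∘ u ≡ p ∘ u' → q ∘ u ≡ q ∘ u' → u ≡ u'
  pullback-jointly-monic {p = p} {q} pb sq {u = u} {u'} pu qu =
    let (_ , _ , _ , unique) = pb (p ∘ u) (q ∘ u) (extendˡ sq)
    in trans (unique u refl refl) (sym (unique u' (sym pu) (sym qu)))

  id-pullback : ∀ {X Y} {f : Hom X Y} → IsPullback f id id f
  id-pullback a b e = a , idˡ , trans e idˡ , λ u' e₁ _ → trans (sym idˡ) e₁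

  pullback-along-id-iso :
    ∀ {P X Y} {f : Hom X Y} {x : Hom P X} {p : Hom P Y} →
    IsPullback f id x p → f ∘ x ≡ id ∘ p →
    Σ (Hom X P) λ y → (x ∘ y ≡ id) × (y ∘ x ≡ id)
  pullback-along-id-iso {f = f} pb sq =
    let (y , xy , py , _) = pb id f (trans idʳ (sym idˡ))
        yx = pullback-jointly-monic pb sq
               (trans (pullˡ xy) (trans idˡ (sym idʳ)))
               (trans (pullˡ py) (trans sq (trans idˡ (sym idʳ))))
    in y , xy , yx

  pullback-paste :
    ∀ {Q P W X Y Z} {f : Hom X Z} {g : Hom Y Z} {p : Hom P X} {q : Hom P Y}
    {h : Hom W Y} {p' : Hom Q P} {q' : Hom Q W} →
    IsPullback f g p q → q ∘ p' ≡ h ∘ q' → IsPullback q h p' q' →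
    IsPullback f (g ∘ h) (p ∘ p') q'
  pullback-paste {p = p} {h = h} {p' = p'} right left-sq left a b e =
    let (a₁ , pa₁ , qa₁ , a₁-unique) = right a (h ∘ b) (trans e assoc)
        (u , p'u , q'u , u-unique) = left a₁ b qa₁
    in u , trans assoc (trans (cong (p ∘_) p'u) pa₁) , q'u ,
       λ u' pp'u' q'u' → u-unique u'
         (a₁-unique (p' ∘ u') (trans (sym assoc) pp'u')
                    (trans (extendˡ left-sq) (cong (h ∘_) q'u')))
         q'u'

  pullback-cancel :
    ∀ {Q P W X Y Z} {f : Hom X Z} {g : Hom Y Z} {p : Hom P X} {q : Hom P Y}
    {h : Hom W Y} {x : Hom Q P} {x' : Hom Q X} {q' : Hom Q W} →
    IsPullback f g p q → f ∘ p ≡ g ∘ q → IsPullback f (g ∘ h) x' q' →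
    p ∘ x ≡ x' → q ∘ x ≡ h ∘ q' → IsPullback q h x q'
  pullback-cancel {g = g} {p} {h = h} right right-sq outer px qx a b e =
    let (u , x'u , q'u , u-unique) =
          outer (p ∘ a) b (trans (extendˡ right-sq) (trans (cong (g ∘_) e) (sym assoc)))
        xu = pullback-jointly-monic right right-sq
               (trans (pullˡ px) x'u)
               (trans (extendˡ qx) (trans (cong (h ∘_) q'u) (sym e)))
    in u , xu , q'u ,
       λ u' xu' q'u' →
         u-unique u' (trans (cong (_∘ u') (sym px)) (trans assoc (cong (p ∘_) xu'))) q'u'

module PiStability {o h t d} (𝒞 : ComprehensionCategory o h t d) where
  open ComprehensionCategory 𝒞
  open Pi 𝒞
  open PullbackLemmas base
  open ≡-Reasoning

  q-square : ∀ {Δ Γ} (σ : Hom Δ Γ) (X : Ty Γ) → χ ∘ q σ X ≡ σ ∘ χ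
  q-square σ X = ext-sq (lift {A = X} {σ = σ})

  q-pullback : ∀ {Δ Γ} (σ : Hom Δ Γ) (X : Ty Γ) → IsPullback χ σ (q σ X) χ
  q-pullback σ X = ext-pb (lift {A = X} {σ = σ}) lift-cart

  ext-subst : ∀ {Δ Γ} {Y : Ty Δ} {X : Ty Γ} {σ σ' : Hom Δ Γ} (e : σ ≡ σ') {f : Over σ Y X} →
              ext (subst (λ s → Over s Y X) e f) ≡ ext f
  ext-subst refl = refl

  ext-∘f : ∀ {Γ} {X Y Z : Ty Γ} (f : Over id Y Z) (g : Over id X Y) → ext (f ∘f g) ≡ ext f ∘ ext g
  ext-∘f f g = trans (ext-subst idˡ) (ext-∘ f g)

  χ∘ext-vertical : ∀ {Γ} {X Y : Ty Γ} (f : Over id X Y) → χ ∘ ext f ≡ χ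
  χ∘ext-vertical f = trans (ext-sq f) idˡ

  q∘ext-factor : ∀ {Θ Δ Γ} {σ : Hom Δ Γ} {X : Ty Γ} (τ : Hom Θ Δ) {Y : Ty Θ}
                 (g : Over (σ ∘ τ) Y X) →
                 q σ X ∘ ext (proj₁ (lift-cart τ g)) ≡ ext g
  q∘ext-factor τ g = trans (sym (ext-∘ lift _)) (cong ext (proj₁ (proj₂ (lift-cart τ g))))

  q∘ext-reindexFib : ∀ {Δ Γ} {X Y : Ty Γ} (f : Over id X Y) (ρ : Hom Δ Γ) →
                     q ρ Y ∘ ext (reindexFib f ρ) ≡ ext f ∘ q ρ X
  q∘ext-reindexFib f ρ =
    trans (q∘ext-factor id _) (trans (ext-subst (trans idˡ (sym idʳ))) (ext-∘ f lift))

  reindexSection-square : ∀ {Δ Γ} {X : Ty Γ} (l : Section Γ X) (σ : Hom Δ Γ) →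
                          q σ X ∘ proj₁ (reindexSection l σ) ≡ proj₁ l ∘ σ
  reindexSection-square {X = X} l σ =
    proj₁ (proj₂ (q-pullback σ X (proj₁ l ∘ σ) id _))

  module Comparison {Γ} {A : Ty Γ} {B : Ty (Γ ▸ A)} (c : PiCand Γ A B) {Δ} (σ : Hom Δ Γ) where
    P : Ty Γ
    P = Π c

    -- ext of the cartesian morphism Π[σ][χ] → Π[χ] lying over σ.A
    comparison : Hom (Δ ▸ A [ σ ] ▸ (P [ σ ]) [ χ ]) (Γ ▸ A ▸ P [ χ ])
    comparison = q (q σ A) (P [ χ ]) ∘ ext (canon P σ)

    comparison-q : q χ P ∘ comparison ≡ q σ P ∘ q χ (P [ σ ])
    comparison-q = begin
      q χ P ∘ comparison ≡⟨ cong (q χ P ∘_) (trans (q∘ext-factor id _) (ext-subst (sym idʳ))) ⟩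
      q χ P ∘ ext cart   ≡⟨ q∘ext-factor (q σ A) _ ⟩
      ext composite      ≡⟨ ext-subst (sym (q-square σ A)) ⟩
      ext (lift {A = P} {σ = σ} ∘ᵈ lift {A = P [ σ ]} {σ = χ}) ≡⟨ ext-∘ lift lift ⟩
      q σ P ∘ q χ (P [ σ ]) ∎
      where
      composite : Over (χ ∘ q σ A) ((P [ σ ]) [ χ ]) P
      composite = subst (λ s → Over s ((P [ σ ]) [ χ ]) P) (sym (q-square σ A))
                    (lift {A = P} {σ = σ} ∘ᵈ lift {A = P [ σ ]} {σ = χ})
      cart : Over (q σ A) ((P [ σ ]) [ χ ]) (P [ χ ])
      cart = proj₁ (lift-cart {A = P} {σ = χ} (q σ A) composite)

    comparison-χ : χ ∘ comparison ≡ q σ A ∘ χ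
    comparison-χ = trans (pullˡ (q-square (q σ A) (P [ χ ])))
                         (trans assoc (cong (q σ A ∘_) (χ∘ext-vertical (canon P σ))))

    q∘ext-app-reindexPi : q (q σ A) B ∘ ext (app (reindexPi c σ)) ≡ ext (app c) ∘ comparison
    q∘ext-app-reindexPi = begin
      q (q σ A) B ∘ ext (app (reindexPi c σ))
        ≡⟨ cong (q (q σ A) B ∘_) (ext-∘f (reindexFib (app c) (q σ A)) (canon P σ)) ⟩
      q (q σ A) B ∘ (ext (reindexFib (app c) (q σ A)) ∘ ext (canon P σ))
        ≡⟨ extendˡ (q∘ext-reindexFib (app c) (q σ A)) ⟩
      ext (app c) ∘ comparison ∎

    comparison∘reindexSection : (l : Section Γ P) →
      comparison ∘ proj₁ (reindexSection (reindexSection l σ) χ) ≡ proj₁ (reindexSection l χ) ∘ q σ A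
    comparison∘reindexSection l = pullback-jointly-monic (q-pullback χ P) (q-square χ P)
      (begin
        q χ P ∘ (comparison ∘ s')         ≡⟨ extendˡ comparison-q ⟩
        q σ P ∘ (q χ (P [ σ ]) ∘ s')      ≡⟨ cong (q σ P ∘_) (reindexSection-square l' χ) ⟩
        q σ P ∘ (proj₁ l' ∘ χ)            ≡⟨ extendˡ (reindexSection-square l σ) ⟩
        proj₁ l ∘ (σ ∘ χ)                 ≡⟨ cong (proj₁ l ∘_) (sym (q-square σ A)) ⟩
        proj₁ l ∘ (χ ∘ q σ A)             ≡⟨ sym (extendˡ (reindexSection-square l χ)) ⟩
        q χ P ∘ (s ∘ q σ A) ∎)
      (begin
        χ ∘ (comparison ∘ s')   ≡⟨ extendˡ comparison-χ ⟩
        q σ A ∘ (χ ∘ s')        ≡⟨ cong (q σ A ∘_) (proj₂ (reindexSection l' χ)) ⟩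
        q σ A ∘ id              ≡⟨ trans idʳ (sym idˡ) ⟩
        id ∘ q σ A              ≡⟨ sym (pullˡ (proj₂ (reindexSection l χ))) ⟩
        χ ∘ (s ∘ q σ A) ∎)
      where
      l' = reindexSection l σ
      s' = proj₁ (reindexSection l' χ)
      s  = proj₁ (reindexSection l χ)

  LamOver : ∀ {Γ A B} → PiCand Γ A B → ∀ {Δ} → Hom Δ Γ → Set (o ⊔ h)
  LamOver {Γ} {A} {B} c {Δ} σ =
    ∀ {X} (x : Hom X (Γ ▸ A)) (p : Hom X Δ) → χ ∘ x ≡ σ ∘ p → IsPullback χ σ x p →
    (tm : Hom X (Γ ▸ A ▸ B)) → χ ∘ tm ≡ x →
    Σ (Hom Δ (Γ ▸ Π c)) λ m → (χ ∘ m ≡ σ) ×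
      (∀ (u : Hom X (Γ ▸ A ▸ Π c [ χ ])) → q χ (Π c) ∘ u ≡ m ∘ p → χ ∘ u ≡ x →
         ext (app c) ∘ u ≡ tm)

  LamOver-id⇒LamOp : ∀ {Γ A B} (c : PiCand Γ A B) → LamOver c id → LamOp c
  LamOver-id⇒LamOp c lamOver tm =
    let (m , χm , m-app) = lamOver id χ (trans idʳ (sym idˡ)) id-pullback (proj₁ tm) (proj₂ tm)
        l = m , χm
        (s , χs) = reindexSection l χ
    in l , m-app s (reindexSection-square l χ) χs

  LamOp⇒LamOver-id : ∀ {Γ A B} (c : PiCand Γ A B) → LamOp c → LamOver c id
  LamOp⇒LamOver-id c lam x p sq pb tm χtm =
    let (y , xy , yx) = pullback-along-id-iso pb sq
        ((m , χm) , isLam) = lam (tm ∘ y , trans (pullˡ χtm) xy)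
        (s , χs) = reindexSection (m , χm) χ
    in m , χm , λ u qu χu →
      let u≡sx : u ≡ s ∘ x
          u≡sx = pullback-jointly-monic (q-pullback χ (Π c)) (q-square χ (Π c))
                   (trans qu (sym (trans (pullˡ (reindexSection-square (m , χm) χ))
                                         (trans assoc (cong (m ∘_) (trans sq idˡ))))))
                   (trans χu (sym (trans (pullˡ χs) idˡ)))
      in begin
        ext (app c) ∘ u       ≡⟨ cong (ext (app c) ∘_) u≡sx ⟩
        ext (app c) ∘ (s ∘ x) ≡⟨ pullˡ isLam ⟩
        (tm ∘ y) ∘ x          ≡⟨ trans assoc (cong (tm ∘_) yx) ⟩
        tm ∘ id               ≡⟨ idʳ ⟩
        tm ∎

  LamOver-reindex : ∀ {Γ A B} (c : PiCand Γ A B) {Δ Θ} (σ : Hom Δ Γ) (τ : Hom Θ Δ) →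
                    LamOver c (σ ∘ τ) → LamOver (reindexPi c σ) τ
  LamOver-reindex {A = A} {B} c σ τ lamOver x p sq pb tm χtm =
    let (m' , χm' , m'-app) =
          lamOver (q σ A ∘ x) p (square-paste (q-square σ A) sq)
                  (pullback-paste (q-pullback σ A) sq pb)
                  (q (q σ A) B ∘ tm)
                  (trans (pullˡ (q-square (q σ A) B)) (trans assoc (cong (q σ A ∘_) χtm)))
        (m , qm , χm , _) = q-pullback σ (Π c) m' τ χm'
    in m , χm , λ u qu χu →
      pullback-jointly-monic (q-pullback (q σ A) B) (q-square (q σ A) B)
        (begin
          q (q σ A) B ∘ (ext (app (reindexPi c σ)) ∘ u) ≡⟨ extendˡ q∘ext-app-reindexPi ⟩
          ext (app c) ∘ (comparison ∘ u)
            ≡⟨ m'-app (comparison ∘ u)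
                 (trans (extendˡ comparison-q) (trans (cong (q σ (Π c) ∘_) qu) (pullˡ qm)))
                 (trans (extendˡ comparison-χ) (cong (q σ A ∘_) χu)) ⟩
          q (q σ A) B ∘ tm ∎)
        (trans (pullˡ (χ∘ext-vertical (app (reindexPi c σ)))) (trans χu (sym χtm)))
    where open Comparison c σ

  LamOver-unreindex : ∀ {Γ A B} (c : PiCand Γ A B) {Δ Θ} (σ : Hom Δ Γ) (τ : Hom Θ Δ) →
                      LamOver (reindexPi c σ) τ → LamOver c (σ ∘ τ)
  LamOver-unreindex {A = A} {B} c σ τ lamOver x' p sq' pb' tm' χtm' =
    let (x , qx , χx , _) = q-pullback σ A x' (τ ∘ p) (trans sq' assoc)
        (tm , qtm , χtm , _) = q-pullback (q σ A) B tm' x (trans χtm' (sym qx))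
        (m , χm , m-app) =
          lamOver x p χx (pullback-cancel (q-pullback σ A) (q-square σ A) pb' qx χx) tm χtm
    in q σ (Π c) ∘ m , trans (pullˡ (q-square σ (Π c))) (trans assoc (cong (σ ∘_) χm)) ,
      λ u' qu' χu' →
        let (u , qu , χu , _) = q-pullback χ (Π c [ σ ]) (m ∘ p) x (trans (pullˡ χm) (sym χx))
            u'≡cu : u' ≡ comparison ∘ u
            u'≡cu = pullback-jointly-monic (q-pullback χ (Π c)) (q-square χ (Π c))
              (trans qu' (sym (trans (extendˡ comparison-q)
                                     (trans (cong (q σ (Π c) ∘_) qu) (sym assoc)))))
              (trans χu' (sym (trans (extendˡ comparison-χ) (trans (cong (q σ A ∘_) χu) qx))))
        in begin
          ext (app c) ∘ u'                             ≡⟨ cong (ext (app c) ∘_) u'≡cu ⟩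
          ext (app c) ∘ (comparison ∘ u)               ≡⟨ extendˡ (sym q∘ext-app-reindexPi) ⟩
          q (q σ A) B ∘ (ext (app (reindexPi c σ)) ∘ u) ≡⟨ cong (q (q σ A) B ∘_) (m-app u qu χu) ⟩
          q (q σ A) B ∘ tm                             ≡⟨ qtm ⟩
          tm' ∎
    where open Comparison c σ

  IsLam-reindex : ∀ {Γ A B} (c : PiCand Γ A B) {Δ} (σ : Hom Δ Γ) {tm l} → IsLam c tm l →
                  IsLam (reindexPi c σ) (reindexSection tm (q σ A)) (reindexSection l σ)
  IsLam-reindex {A = A} {B} c σ {tm} {l} isLam =
    pullback-jointly-monic (q-pullback (q σ A) B) (q-square (q σ A) B)
      (begin
        q (q σ A) B ∘ (ext (app (reindexPi c σ)) ∘ s') ≡⟨ extendˡ q∘ext-app-reindexPi ⟩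
        ext (app c) ∘ (comparison ∘ s')   ≡⟨ cong (ext (app c) ∘_) (comparison∘reindexSection l) ⟩
        ext (app c) ∘ (proj₁ (reindexSection l χ) ∘ q σ A) ≡⟨ pullˡ isLam ⟩
        proj₁ tm ∘ q σ A                  ≡⟨ sym (reindexSection-square tm (q σ A)) ⟩
        q (q σ A) B ∘ proj₁ (reindexSection tm (q σ A)) ∎)
      (trans (pullˡ (χ∘ext-vertical (app (reindexPi c σ))))
             (trans (proj₂ (reindexSection (reindexSection l σ) χ))
                    (sym (proj₂ (reindexSection tm (q σ A))))))
    where
    open Comparison c σ
    s' = proj₁ (reindexSection (reindexSection l σ) χ)

  weaklyStable⇒stableClass : WeaklyStablePi → StableClass (o ⊔ h ⊔ t ⊔ d)
  weaklyStable⇒stableClass weaklyStable = record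
    { Good           = λ {Γ} c → Lift (o ⊔ h ⊔ t ⊔ d) (∀ Δ (σ : Hom Δ Γ) → LamOver c σ)
    ; good-ne        = λ Γ A B →
        let (c , lam) = weaklyStable Γ A B
        in c , lift-ℓ λ Δ σ → subst (LamOver c) idʳ
                 (LamOver-unreindex c σ id (LamOp⇒LamOver-id (reindexPi c σ) (lam Δ σ)))
    ; good-stable    = λ {c = c} good σ →
        lift-ℓ λ Θ τ → LamOver-reindex c σ τ (lower good Θ (σ ∘ τ))
    ; GoodLam        = λ c tm l → Lift (o ⊔ h ⊔ t ⊔ d) (IsLam c tm l)
    ; goodLam-lam    = λ _ → lower
    ; goodLam-ne     = λ {Γ} {c = c} good tm →
        let (l , isLam) = LamOver-id⇒LamOp c (lower good Γ id) tm in l , lift-ℓ isLam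
    ; goodLam-stable = λ {c = c} {tm} {l} _ isLam σ →
        lift-ℓ (IsLam-reindex c σ {tm} {l} (lower isLam))
    }

  stableClass⇒weaklyStable : ∀ {ℓ} → StableClass ℓ → WeaklyStablePi
  stableClass⇒weaklyStable sc Γ A B =
    let (c , good) = good-ne Γ A B
    in c , λ Δ σ tm →
      let (l , goodLam) = goodLam-ne (good-stable good σ) tm
      in l , goodLam-lam (good-stable good σ) goodLam
    where open StableClass sc

proposition3p4p2p7 : ∀ {o h t d} (𝒞 : ComprehensionCategory o h t d) →
    Pi.WeaklyStablePi 𝒞 ⇔ Pi.StableClass 𝒞 (o ⊔ h ⊔ t ⊔ d)
proposition3p4p2p7 𝒞 =
  mk⇔ (PiStability.weaklyStable⇒stableClass 𝒞) (PiStability.stableClass⇒weaklyStable 𝒞)
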